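{- Let $\mathcal{G}=(\mathcal{V},\mathit{Act},\mathcal{R})$ be a normed BPA system with no silent variables, and $\gamma,\delta\in\mathcal{V}^*$. If $\mathrm{Red}(\gamma)=\mathrm{Red}(\delta)$, then $\sim_\gamma\,=\,\sim_\delta$ and $\|\cdot\|_{\mathrm{cc},\gamma}=\|\cdot\|_{\mathrm{cc},\delta}$ (i.e., for all $\alpha,\beta\in\mathcal{V}^*$: $\alpha\gamma\sim\beta\gamma$ iff $\alpha\delta\sim\beta\delta$, and $\|\alpha\|_{\mathrm{cc},\gamma}=\|\alpha\|_{\mathrm{cc},\delta}$).
   Context: Branching bisimulation on an LTS (with silent action $\tau$): a symmetric relation $\mathcal{B}$ such that for every $(s,t)\in\mathcal{B}$ and $s\xrightarrow{a}s'$, either $a=\tau$ and $(s',t)\in\mathcal{B}$, or there are $k\ge0$ and $t=t_0\xrightarrow{\tau}\cdots\xrightarrow{\tau}t_k\xrightarrow{a}t'$ with $(s',t')\in\mathcal{B}$ and $(s,t_i)\in\mathcal{B}$ for $1\le i\le k$; $\sim$ is the union of all branching bisimulations. A BPA system $\mathcal{G}=(\mathcal{V},\mathit{Act},\mathcal{R})$: finite variables $\mathcal{V}$, finite actions $\mathit{Act}$ (possibly containing $\tau$), finite rules $A\xrightarrow{a}\alpha$ with $A\in\mathcal{V},\alpha\in\mathcal{V}^*$; its LTS has states $\mathcal{V}^*$ and transitions $A\beta\xrightarrow{a}\alpha\beta$ for each rule and each $\beta$; normed means every variable $A$ has $A\xrightarrow{w}\varepsilon$ for some $w$. A variable $A$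 is silent if $A\xrightarrow{w}\alpha$ implies $w\in\{\tau\}^*$. A transition $\alpha\xrightarrow{a}\beta$ is class-changing if $\alpha\not\sim\beta$; the cc-length of a path is its number of class-changing transitions; $\|\alpha\|_{\mathrm{cc}}$ is the minimum cc-length of a path $\alpha\xrightarrow{w}\varepsilon$. $\mathrm{Red}(\beta)=\{X\in\mathcal{V}\mid X\beta\sim\beta\}$. For $\gamma\in\mathcal{V}^*$: $\alpha\sim_\gamma\beta$ iff $\alpha\gamma\sim\beta\gamma$, and $\|\alpha\|_{\mathrm{cc},\gamma}=\|\alpha\gamma\|_{\mathrm{cc}}-\|\gamma\|_{\mathrm{cc}}$. -}

module Defs where

open import Level using (Level; suc; zero)
open import Data.Nat using (ℕ; _≤_) renaming (suc to sucℕ)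
open import Data.Fin using (Fin)
open import Data.Maybe using (Maybe; nothing; just)
open import Data.List using (List; []; _∷_; _++_; [_])
open import Data.List.Membership.Propositional using (_∈_)
open import Data.List.Relation.Unary.All using (All)
open import Data.Product using (_×_; _,_; ∃; ∃-syntax)
open import Data.Sum using (_⊎_)
open import Relation.Binary.PropositionalEquality using (_≡_)
open import Relation.Nullary using (¬_)

record BPA : Set where
  field
    nV    : ℕ
    nA    : ℕ
    rules : List (Fin nV × Maybe (Fin nA) × List (Fin nV))

module _ (G : BPA) where
  open BPA G

  Var : Set
  Var = Fin nV

  Act : Set
  Act = Maybe (Fin nA)

  τ : Act
  τ = nothing

  data _⟶[_]_ : List Var → Act → List Var → Set where
    rule : ∀ {A a α β} → (A , a , α) ∈ rules → (A ∷ β) ⟶[ a ] (α ++ β)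

  data _⟹[_]_ : List Var → List Act → List Var → Set where
    refl⟹ : ∀ {α} → α ⟹[ [] ] α
    step⟹ : ∀ {α β γ a w} → α ⟶[ a ] β → β ⟹[ w ] γ → α ⟹[ a ∷ w ] γ

  Silent : Var → Set
  Silent A = ∀ w α → [ A ] ⟹[ w ] α → All (_≡ τ) w

  NoSilentVariables : Set
  NoSilentVariables = ∀ A → ¬ Silent A

  Normed : Set
  Normed = ∀ A → ∃[ w ] ([ A ] ⟹[ w ] [])

  -- t = t₀ --τ--> t₁ ... --τ--> tₖ  with P tᵢ for 1 ≤ i ≤ k
  data TauSeq (P : List Var → Set) : List Var → List Var → Set where
    done  : ∀ {t} → TauSeq P t t
    step  : ∀ {t u v} → t ⟶[ τ ] u → P u → TauSeq P u v → TauSeq P t v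

  IsBranchingBisim : (List Var → List Var → Set) → Set
  IsBranchingBisim B =
    (∀ s t → B s t → B t s) ×
    (∀ s t a s' → B s t → s ⟶[ a ] s' →
       (a ≡ τ × B s' t) ⊎
       (∃[ tk ] ∃[ t' ] (TauSeq (B s) t tk × tk ⟶[ a ] t' × B s' t')))

  _∼_ : List Var → List Var → Set₁
  s ∼ t = ∃[ B ] (IsBranchingBisim B × B s t)

  InRed : Var → List Var → Set₁
  InRed X β = (X ∷ β) ∼ β

  data CCPath : List Var → List Var → ℕ → Set₁ where
    nil    : ∀ {α} → CCPath α α 0
    keep   : ∀ {α β γ a k} → α ⟶[ a ] β → α ∼ β → CCPath β γ k → CCPath α γ k
    change : ∀ {α β γ a k} → α ⟶[ a ] β → ¬ (α ∼ β) → CCPath β γ k → CCPath α γ (sucℕ k)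

  IsCcNorm : List Var → ℕ → Set₁
  IsCcNorm α n = CCPath α [] n × (∀ k → CCPath α [] k → n ≤ k)

-- Say γ absorbs α when αγ ∼ γ. Since no variable is silent, ε is alone in its ∼-class, so if
-- αγ ∼ γ then αγ, answering a path of the normed γ to ε, must consume α without leaving the class
-- of γ; hence absorption passes to suffixes, and by induction on α, Red(γ) ⊆ Red(δ) turns
-- absorption by γ into absorption by δ. A bisimulation relating αγ and βγ is then transported to
-- αδ and βδ by exchanging the tail γ for δ, switching to a witness of absorption as soon as one
-- side has been reduced to the bare tail. Finally, a path from αγ to ε first consumes α and then
-- runs from γ; its class changes in the first part are judged by ∼_γ = ∼_δ, which gives the
-- equality of the relative cc-norms.

module Submission where

open import Defs
open import Level using (0ℓ)
open import Data.Nat using (ℕ; suc; _+_; _≤_; _<_)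
open import Data.Nat.Properties using (≤-refl; ≤-antisym; m<n⇒m<1+n; +-mono-≤; +-comm; +-commutativeSemigroup; module ≤-Reasoning)
open import Algebra.Properties.CommutativeSemigroup +-commutativeSemigroup using (xy∙z≈xz∙y)
open import Data.Nat.Induction using (<-wellFounded)
open import Induction.WellFounded using (Acc; acc)
open import Data.Integer using (+_; _-_; _⊖_)
open import Data.Integer.Properties using ([+m]-[+n]≡m⊖n; +-cancelˡ-⊖)
open import Data.List using (List; []; _∷_; _++_; [_]; length)
open import Data.List.Properties using (++-assoc)
open import Data.List.Membership.Propositional using (_∈_)
open import Data.List.Relation.Unary.All using (All; []; _∷_)
open import Data.Product using (_×_; _,_; proj₁; proj₂; Σ; ∃-syntax)
open import Data.Sum using (_⊎_; inj₁; inj₂)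
open import Data.Empty using (⊥-elim)
open import Relation.Nullary using (¬_)
open import Relation.Binary.Core using (Rel)
open import Relation.Binary.Construct.Composition using () renaming (_;_ to _⨾_)
open import Relation.Binary.Construct.Union using (_∪_)
open import Relation.Binary.PropositionalEquality using (_≡_; refl; sym; trans; cong; cong₂; subst; module ≡-Reasoning)
open import Function.Base using (_∘_)
open import Function.Bundles using (_⇔_; mk⇔; Equivalence)
import Function.Properties.Equivalence as ⇔

module BPATheory (G : BPA) where
  open BPA G using (rules)

  State : Set
  State = List (Var G)

  infix 4 _⟶⟨_⟩_ _⟹⟨_⟩_ _≈_

  _⟶⟨_⟩_ : State → Act G → State → Set
  s ⟶⟨ a ⟩ t = _⟶[_]_ G s a t

  _⟹⟨_⟩_ : State → List (Act G) → State → Set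
  s ⟹⟨ w ⟩ t = _⟹[_]_ G s w t

  _≈_ : State → State → Set₁
  s ≈ t = _∼_ G s t

  private variable
    s s' t u : State
    ρ σ : State
    w : List (Act G)
    a : Act G
    X : Var G
    B C : Rel State 0ℓ
    P Q : State → Set

  ⟶-inv : s ⟶⟨ a ⟩ u → s ≡ X ∷ ρ → ∃[ ξ ] ((X , a , ξ) ∈ rules × u ≡ ξ ++ ρ)
  ⟶-inv (rule r) refl = _ , r , refl

  rule-++ : ∀ {ξ} σ ρ → (X , a , ξ) ∈ rules → (X ∷ σ) ++ ρ ⟶⟨ a ⟩ (ξ ++ σ) ++ ρ
  rule-++ {ξ = ξ} σ ρ r rewrite ++-assoc ξ σ ρ = rule r

  ⟶-++ʳ : ∀ ρ → s ⟶⟨ a ⟩ s' → s ++ ρ ⟶⟨ a ⟩ s' ++ ρ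
  ⟶-++ʳ ρ (rule {β = σ} r) = rule-++ σ ρ r

  ⟹-++ʳ : ∀ ρ → s ⟹⟨ w ⟩ s' → s ++ ρ ⟹⟨ w ⟩ s' ++ ρ
  ⟹-++ʳ ρ refl⟹ = refl⟹
  ⟹-++ʳ ρ (step⟹ tr p) = step⟹ (⟶-++ʳ ρ tr) (⟹-++ʳ ρ p)

  ⟹-trans : ∀ {v} → s ⟹⟨ w ⟩ t → t ⟹⟨ v ⟩ u → s ⟹⟨ w ++ v ⟩ u
  ⟹-trans refl⟹ q = q
  ⟹-trans (step⟹ tr p) q = step⟹ tr (⟹-trans p q)

  normed⇒⟹[] : Normed G → ∀ β → ∃[ w ] (β ⟹⟨ w ⟩ [])
  normed⇒⟹[] normed [] = [] , refl⟹
  normed⇒⟹[] normed (X ∷ β) with normed X | normed⇒⟹[] normed β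
  ... | w , p | v , q = w ++ v , ⟹-trans (⟹-++ʳ β p) q

  TauSeq-map : (∀ {x} → P x → Q x) → TauSeq G P t u → TauSeq G Q t u
  TauSeq-map f done = done
  TauSeq-map f (step tr p r) = step tr (f p) (TauSeq-map f r)

  TauSeq-++ : TauSeq G P s t → TauSeq G P t u → TauSeq G P s u
  TauSeq-++ done q = q
  TauSeq-++ (step tr p r) q = step tr p (TauSeq-++ r q)

  TauSeq-unsnoc : TauSeq G P t u → t ≡ u ⊎ ∃[ m ] (TauSeq G P t m × m ⟶⟨ τ G ⟩ u × P u)
  TauSeq-unsnoc done = inj₁ refl
  TauSeq-unsnoc (step tr p r) with TauSeq-unsnoc r
  ... | inj₁ refl = inj₂ (_ , done , tr , p)
  ... | inj₂ (m , r' , tr' , p') = inj₂ (m , step tr p r' , tr' , p')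

  IsBisim : Rel State 0ℓ → Set
  IsBisim = IsBranchingBisim G

  Response : Rel State 0ℓ → State → Act G → State → State → Set
  Response B s a s' t =
    (a ≡ τ G × B s' t) ⊎ ∃[ tk ] ∃[ t' ] (TauSeq G (B s) t tk × tk ⟶⟨ a ⟩ t' × B s' t')

  IsBisim-sym : IsBisim B → B s t → B t s
  IsBisim-sym (symmetric , _) st = symmetric _ _ st

  respond : IsBisim B → B s t → s ⟶⟨ a ⟩ s' → Response B s a s' t
  respond (_ , transfer) st tr = transfer _ _ _ _ st tr

  Response-map : (∀ {x y} → B x y → C x y) → Response B s a s' t → Response C s a s' t
  Response-map f (inj₁ (eq , b)) = inj₁ (eq , f b)
  Response-map f (inj₂ (tk , t' , sq , tr , b)) = inj₂ (tk , t' , TauSeq-map f sq , tr , f b)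

  Response-τ-prefix : t ⟶⟨ τ G ⟩ u → B s u → Response B s a s' u → Response B s a s' t
  Response-τ-prefix {t = t} {u = u} tr b (inj₁ (refl , b')) = inj₂ (t , u , done , tr , b')
  Response-τ-prefix tr b (inj₂ (tk , t' , sq , tr' , b')) = inj₂ (tk , t' , step tr b sq , tr' , b')

  ∼-refl : s ≈ s
  ∼-refl = _≡_ , ((λ _ _ → sym) , λ { s .s a s' refl tr → inj₂ (s , s' , done , tr , refl) }) , refl

  ∼-sym : s ≈ t → t ≈ s
  ∼-sym (B , bisim , st) = B , bisim , IsBisim-sym bisim st

  module Composition {B C : Rel State 0ℓ} (bisimB : IsBisim B) (bisimC : IsBisim C) where

    follow : ∀ {tk} → TauSeq G (B s) t tk → B s t → C t u →
             ∃[ uk ] (TauSeq G ((B ⨾ C) s) u uk × B s tk × C tk uk)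
    follow done b c = _ , done , b , c
    follow {t = t} (step {u = t₁} tr b₁ rest) b c with respond bisimC c tr
    ... | inj₁ (_ , c₁) = follow rest b₁ c₁
    ... | inj₂ (um , u₁ , sq , tr' , c₁) with follow rest b₁ c₁
    ...   | uk , sq' , bk , ck =
            uk , TauSeq-++ (TauSeq-map (λ c' → t , b , c') sq) (step tr' (t₁ , b₁ , c₁) sq') , bk , ck

    respond-compose : (B ⨾ C) s u → s ⟶⟨ a ⟩ s' → Response (B ⨾ C) s a s' u
    respond-compose (t , b , c) tr with respond bisimB b tr
    ... | inj₁ (eq , b') = inj₁ (eq , t , b' , c)
    ... | inj₂ (tk , t' , sq , tr' , b') with follow sq b c
    ...   | uk , usq , bk , ck with respond bisimC ck tr'
    ...     | inj₂ (ul , u' , usq' , trl , c') =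
              inj₂ (ul , u' , TauSeq-++ usq (TauSeq-map (λ c'' → tk , bk , c'') usq') , trl , t' , b' , c')
    ...     | inj₁ (eq , c') with TauSeq-unsnoc usq
    ...       | inj₁ refl = inj₁ (eq , t' , b' , c')
    ...       | inj₂ (um , usq'' , trm , _) rewrite eq = inj₂ (um , uk , usq'' , trm , t' , b' , c')

  ∼-trans : s ≈ t → t ≈ u → s ≈ u
  ∼-trans (B , bisimB , b) (C , bisimC , c) = D , (sym-D , respond-D) , inj₁ (_ , b , c)
    where
    D : Rel State 0ℓ
    D = (B ⨾ C) ∪ (C ⨾ B)
    sym-D : ∀ s u → D s u → D u s
    sym-D s u (inj₁ (t , b , c)) = inj₂ (t , IsBisim-sym bisimC c , IsBisim-sym bisimB b)
    sym-D s u (inj₂ (t , c , b)) = inj₁ (t , IsBisim-sym bisimB b , IsBisim-sym bisimC c)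
    respond-D : ∀ s u a s' → D s u → s ⟶⟨ a ⟩ s' → Response D s a s' u
    respond-D s u a s' (inj₁ bc) tr = Response-map {B = B ⨾ C} inj₁ (Composition.respond-compose bisimB bisimC bc tr)
    respond-D s u a s' (inj₂ cb) tr = Response-map {B = C ⨾ B} inj₂ (Composition.respond-compose bisimC bisimB cb tr)

  ∼-++ˡ : ∀ β → ρ ≈ σ → β ++ ρ ≈ β ++ σ
  ∼-++ˡ {ρ} {σ} β (B , bisim , b) = D , (sym-D , respond-D) , inj₂ (β , ρ , σ , refl , refl , b)
    where
    Prefixed : Rel State 0ℓ
    Prefixed s t = ∃[ β ] ∃[ ρ ] ∃[ σ ] (s ≡ β ++ ρ × t ≡ β ++ σ × B ρ σ)
    D : Rel State 0ℓ
    D = B ∪ Prefixed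
    sym-D : ∀ s t → D s t → D t s
    sym-D s t (inj₁ b) = inj₁ (IsBisim-sym bisim b)
    sym-D s t (inj₂ (β , ρ , σ , e₁ , e₂ , b)) = inj₂ (β , σ , ρ , e₂ , e₁ , IsBisim-sym bisim b)
    respond-D : ∀ s t a s' → D s t → s ⟶⟨ a ⟩ s' → Response D s a s' t
    respond-D s t a s' (inj₁ b) tr = Response-map {B = B} inj₁ (respond bisim b tr)
    respond-D s t a s' (inj₂ ([] , ρ , σ , refl , refl , b)) tr = Response-map {B = B} inj₁ (respond bisim b tr)
    respond-D s t a s' (inj₂ (Y ∷ β , ρ , σ , refl , refl , b)) tr with ⟶-inv tr refl
    ... | ξ , r , refl =
      inj₂ (_ , _ , done , rule r , inj₂ (ξ ++ β , ρ , σ , sym (++-assoc ξ β ρ) , sym (++-assoc ξ β σ) , b))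

  τ-only-from-B[] : IsBisim B → B s [] → s ⟹⟨ w ⟩ s' → All (_≡ τ G) w
  τ-only-from-B[] bisim b refl⟹ = []
  τ-only-from-B[] bisim b (step⟹ tr p) with respond bisim b tr
  ... | inj₁ (eq , b') = eq ∷ τ-only-from-B[] bisim b' p
  ... | inj₂ (_ , _ , done , () , _)
  ... | inj₂ (_ , _ , step () _ _ , _ , _)

  ≈[]⇒≡[] : NoSilentVariables G → ∀ {s} → s ≈ [] → s ≡ []
  ≈[]⇒≡[] noSilent {[]} _ = refl
  ≈[]⇒≡[] noSilent {X ∷ ρ} (B , bisim , b) =
    ⊥-elim (noSilent X λ w α p → τ-only-from-B[] bisim b (⟹-++ʳ ρ p))

  data Walk (𝒫 : State → Set₁) : State → Set₁ where
    end  : 𝒫 [] → Walk 𝒫 []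
    next : ∀ {X a ξ ρ} → (X , a , ξ) ∈ rules → 𝒫 (X ∷ ρ) → Walk 𝒫 (ξ ++ ρ) → Walk 𝒫 (X ∷ ρ)

  module _ {𝒫 : State → Set₁} where

    Walk-head : ∀ {β} → Walk 𝒫 β → 𝒫 β
    Walk-head (end p) = p
    Walk-head (next _ p _) = p

    Walk-last : ∀ {β} → Walk 𝒫 β → 𝒫 []
    Walk-last (end p) = p
    Walk-last (next _ _ walk) = Walk-last walk

    Walk-map : ∀ {𝒬 : State → Set₁} {β} → (∀ {x} → 𝒫 x → 𝒬 x) → Walk 𝒫 β → Walk 𝒬 β
    Walk-map f (end p) = end (f p)
    Walk-map f (next r p walk) = next r (f p) (Walk-map f walk)

    Walk-suffix : ∀ {β} → Walk 𝒫 β → ∀ σ ρ → β ≡ σ ++ ρ → 𝒫 ρ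
    Walk-suffix walk [] ρ refl = Walk-head walk
    Walk-suffix (next {ξ = ξ} _ _ walk) (Y ∷ σ) ρ refl = Walk-suffix walk (ξ ++ σ) ρ (sym (++-assoc ξ σ ρ))

  module Absorption (noSilent : NoSilentVariables G) (γ : State) where

    TauSeq-walk : IsBisim B → ∀ {tk} → TauSeq G (B u) t tk → ∀ β → t ≡ β ++ γ → β ++ γ ≈ u →
                  Walk (λ ρ → ρ ++ γ ≈ u) β ⊎ ∃[ Y ] ∃[ σ ] (tk ≡ (Y ∷ σ) ++ γ)
    TauSeq-walk bisim sq [] e h = inj₁ (end h)
    TauSeq-walk bisim done (Y ∷ σ) e h = inj₂ (Y , σ , e)
    TauSeq-walk {B = B} {u = u} bisim (step tr b rest) (Y ∷ σ) e h with ⟶-inv tr e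
    ... | ξ , r , e₁ with TauSeq-walk bisim rest (ξ ++ σ) e₂ (subst (_≈ u) e₂ (∼-sym (B , bisim , b)))
      where e₂ = trans e₁ (sym (++-assoc ξ σ γ))
    ...   | inj₁ walk = inj₁ (next r h walk)
    ...   | inj₂ stuck = inj₂ stuck

    Closer : ℕ → Set₁
    Closer n = ∃[ u' ] ∃[ w' ] (u' ⟹⟨ w' ⟩ [] × length w' < n × γ ≈ u')

    Closer-suc : ∀ {n} → Closer n → Closer (suc n)
    Closer-suc (u' , w' , π , lt , γ≈u') = u' , w' , π , m<n⇒m<1+n lt , γ≈u'

    walk-or-closer : u ⟹⟨ w ⟩ [] → ∀ β → β ++ γ ≈ u → Walk (λ ρ → ρ ++ γ ≈ u) β ⊎ Closer (length w)
    walk-or-closer π [] h = inj₁ (end h)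
    walk-or-closer refl⟹ (X ∷ β) h with ≈[]⇒≡[] noSilent h
    ... | ()
    walk-or-closer (step⟹ tr π) (X ∷ β) h with ∼-sym h
    ... | B , bisim , b with respond bisim b tr
    ...   | inj₁ (_ , b₁) with walk-or-closer π (X ∷ β) (∼-sym (B , bisim , b₁))
    ...     | inj₁ walk = inj₁ (Walk-map (λ p → ∼-trans p (∼-trans (B , bisim , b₁) h)) walk)
    ...     | inj₂ closer = inj₂ (Closer-suc closer)
    walk-or-closer (step⟹ {β = u₁} {w = w} tr π) (X ∷ β) h | B , bisim , b
        | inj₂ (tk , t' , sq , tr' , b') with TauSeq-walk bisim sq (X ∷ β) refl h
    ...   | inj₁ walk = inj₁ walk
    ...   | inj₂ (Y , σ , e) with ⟶-inv tr' e
    ...     | ζ , _ , e₁ with walk-or-closer π (ζ ++ σ)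
                (subst (_≈ u₁) (trans e₁ (sym (++-assoc ζ σ γ))) (∼-sym (B , bisim , b')))
    ...       | inj₁ walk = inj₂ (u₁ , w , π , ≤-refl , Walk-last walk)
    ...       | inj₂ closer = inj₂ (Closer-suc closer)

    walk-in-class : Acc _<_ (length w) → u ⟹⟨ w ⟩ [] → γ ≈ u → ∀ β → β ++ γ ≈ u →
                    Walk (λ ρ → ρ ++ γ ≈ γ) β
    walk-in-class (acc rs) π γ≈u β h with walk-or-closer π β h
    ... | inj₁ walk = Walk-map (λ p → ∼-trans p (∼-sym γ≈u)) walk
    ... | inj₂ (u' , w' , π' , lt , γ≈u') =
          walk-in-class (rs lt) π' γ≈u' β (∼-trans h (∼-trans (∼-sym γ≈u) γ≈u'))

  absorbs-suffix : Normed G → NoSilentVariables G → ∀ γ σ ρ → (σ ++ ρ) ++ γ ≈ γ → ρ ++ γ ≈ γ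
  absorbs-suffix normed noSilent γ σ ρ h with normed⇒⟹[] normed γ
  ... | w , π = Walk-suffix (walk-in-class (<-wellFounded (length w)) π ∼-refl (σ ++ ρ) h) σ ρ refl
    where open Absorption noSilent γ

  absorbs-transfer : Normed G → NoSilentVariables G → ∀ {γ δ} → (∀ X → InRed G X γ → InRed G X δ) →
                     ∀ α → α ++ γ ≈ γ → α ++ δ ≈ δ
  absorbs-transfer normed noSilent red [] _ = ∼-refl
  absorbs-transfer normed noSilent {γ} red (X ∷ α) h =
    ∼-trans (∼-++ˡ [ X ] (absorbs-transfer normed noSilent red α αγ≈γ)) (red X Xγ≈γ)
    where
    αγ≈γ : α ++ γ ≈ γ
    αγ≈γ = absorbs-suffix normed noSilent γ [ X ] α h
    Xγ≈γ : X ∷ γ ≈ γ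
    Xγ≈γ = ∼-trans (∼-++ˡ [ X ] (∼-sym αγ≈γ)) h

  module Transfer {γ δ : State} (absorbs : ∀ α → α ++ γ ≈ γ → α ++ δ ≈ δ)
                  {B₀ : Rel State 0ℓ} (bisim₀ : IsBisim B₀) where

    -- ∼ lives in Set₁, so the bisimulations witnessing absorption by δ are gathered into a single
    -- Set-valued relation by indexing them with the absorbed pairs they come from.
    Absorbed : Set
    Absorbed = Σ State λ α → B₀ (α ++ γ) γ

    witness : (i : Absorbed) → proj₁ i ++ δ ≈ δ
    witness (α , b) = absorbs α (B₀ , bisim₀ , b)

    Absorbing : Rel State 0ℓ
    Absorbing s t = Σ Absorbed λ i → proj₁ (witness i) s t

    absorbing : ∀ {α} → B₀ (α ++ γ) γ → Absorbing (α ++ δ) δ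
    absorbing b = (_ , b) , proj₂ (proj₂ (witness (_ , b)))

    Absorbing-sym : Absorbing s t → Absorbing t s
    Absorbing-sym (i , b) = i , IsBisim-sym (proj₁ (proj₂ (witness i))) b

    respond-Absorbing : Absorbing s t → s ⟶⟨ a ⟩ s' → Response Absorbing s a s' t
    respond-Absorbing (i , b) tr =
      Response-map {B = proj₁ (witness i)} (i ,_) (respond (proj₁ (proj₂ (witness i))) b tr)

    Shifted : Rel State 0ℓ
    Shifted s t = ∃[ α ] ∃[ β ] (s ≡ α ++ δ × t ≡ β ++ δ × B₀ (α ++ γ) (β ++ γ))

    D : Rel State 0ℓ
    D = Shifted ∪ Absorbing

    sym-D : ∀ s t → D s t → D t s
    sym-D s t (inj₁ (α , β , e₁ , e₂ , b)) = inj₁ (β , α , e₂ , e₁ , IsBisim-sym bisim₀ b)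
    sym-D s t (inj₂ ab) = inj₂ (Absorbing-sym ab)

    respond-D-Absorbing : Absorbing s t → s ⟶⟨ a ⟩ s' → Response D s a s' t
    respond-D-Absorbing ab tr = Response-map {B = Absorbing} {C = D} inj₂ (respond-Absorbing ab tr)

    -- The answer of βγ to  Xαγ ⟶ ξαγ  is replayed on βδ; should β be used up on the way, the
    -- pair (Xαδ, δ) is absorbed and answers by itself.
    replay : ∀ {X a ξ t tk t'} α → (X , a , ξ) ∈ rules → ∀ β → t ≡ β ++ γ →
             TauSeq G (B₀ ((X ∷ α) ++ γ)) t tk → B₀ ((X ∷ α) ++ γ) t →
             tk ⟶⟨ a ⟩ t' → B₀ ((ξ ++ α) ++ γ) t' →
             Response D ((X ∷ α) ++ δ) a ((ξ ++ α) ++ δ) (β ++ δ)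
    replay {X = X} α r [] refl _ b _ _ =
      respond-D-Absorbing (absorbing {X ∷ α} b) (rule-++ α δ r)
    replay α r (Y ∷ σ) e done _ tr' b' with ⟶-inv tr' e
    ... | ζ , r' , e₁ =
      inj₂ (_ , _ , done , rule-++ σ δ r' ,
            inj₁ (_ , ζ ++ σ , refl , refl , subst (B₀ _) (trans e₁ (sym (++-assoc ζ σ γ))) b'))
    replay {X = X} α r (Y ∷ σ) e (step tr b₁ rest) _ tr' b' with ⟶-inv tr e
    ... | ζ , r' , e₁ =
      Response-τ-prefix {B = D} (rule-++ σ δ r') (inj₁ (X ∷ α , ζ ++ σ , refl , refl , subst (B₀ _) e₂ b₁))
        (replay α r (ζ ++ σ) e₂ rest b₁ tr' b')
      where e₂ = trans e₁ (sym (++-assoc ζ σ γ))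

    respond-D : ∀ s t a s' → D s t → s ⟶⟨ a ⟩ s' → Response D s a s' t
    respond-D _ _ _ _ (inj₂ ab) tr = respond-D-Absorbing ab tr
    respond-D _ _ _ _ (inj₁ ([] , β , refl , refl , b)) tr =
      respond-D-Absorbing (Absorbing-sym (absorbing {β} (IsBisim-sym bisim₀ b))) tr
    respond-D _ _ _ _ (inj₁ (X ∷ α , [] , refl , refl , b)) tr =
      respond-D-Absorbing (absorbing {X ∷ α} b) tr
    respond-D _ _ a _ (inj₁ (X ∷ α , Y ∷ β , refl , refl , b)) tr with ⟶-inv tr refl
    ... | ξ , r , refl with respond bisim₀ b (rule-++ α γ r)
    ...   | inj₁ (eq , b') = inj₁ (eq , inj₁ (ξ ++ α , Y ∷ β , sym (++-assoc ξ α δ) , refl , b'))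
    ...   | inj₂ (tk , t' , sq , tr' , b') =
            subst (λ s' → Response D _ a s' _) (++-assoc ξ α δ) (replay α r (Y ∷ β) refl sq b tr' b')

    transport : ∀ α β → B₀ (α ++ γ) (β ++ γ) → α ++ δ ≈ β ++ δ
    transport α β b = D , (sym-D , respond-D) , inj₁ (α , β , refl , refl , b)

  ∼-transfer : Normed G → NoSilentVariables G → ∀ {γ δ} → (∀ X → InRed G X γ → InRed G X δ) →
               ∀ α β → α ++ γ ≈ β ++ γ → α ++ δ ≈ β ++ δ
  ∼-transfer normed noSilent red α β (B₀ , bisim₀ , b) =
    Transfer.transport (absorbs-transfer normed noSilent red) bisim₀ α β b

  data CCPathIn (γ : State) : State → ℕ → Set₁ where
    nil    : CCPathIn γ [] 0
    keep   : ∀ {X a ξ ρ k} → (X , a , ξ) ∈ rules → (X ∷ ρ) ++ γ ≈ (ξ ++ ρ) ++ γ →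
             CCPathIn γ (ξ ++ ρ) k → CCPathIn γ (X ∷ ρ) k
    change : ∀ {X a ξ ρ k} → (X , a , ξ) ∈ rules → ¬ ((X ∷ ρ) ++ γ ≈ (ξ ++ ρ) ++ γ) →
             CCPathIn γ (ξ ++ ρ) k → CCPathIn γ (X ∷ ρ) (suc k)

  CCPathIn⇒CCPath : ∀ {γ β k} → CCPathIn γ β k → CCPath G (β ++ γ) γ k
  CCPathIn⇒CCPath nil = nil
  CCPathIn⇒CCPath {γ} (keep {ρ = ρ} r h p) = keep (rule-++ ρ γ r) h (CCPathIn⇒CCPath p)
  CCPathIn⇒CCPath {γ} (change {ρ = ρ} r h p) = change (rule-++ ρ γ r) h (CCPathIn⇒CCPath p)

  CCPathIn-transfer : ∀ {γ δ} → (∀ α β → (α ++ γ ≈ β ++ γ) ⇔ (α ++ δ ≈ β ++ δ)) →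
                      ∀ {β k} → CCPathIn γ β k → CCPathIn δ β k
  CCPathIn-transfer E nil = nil
  CCPathIn-transfer E (keep {X = X} {ξ = ξ} {ρ = ρ} r h p) =
    keep r (Equivalence.to (E (X ∷ ρ) (ξ ++ ρ)) h) (CCPathIn-transfer E p)
  CCPathIn-transfer E (change {X = X} {ξ = ξ} {ρ = ρ} r h p) =
    change r (h ∘ Equivalence.from (E (X ∷ ρ) (ξ ++ ρ))) (CCPathIn-transfer E p)

  CCPath-++ : ∀ {k m} → CCPath G s t k → CCPath G t u m → CCPath G s u (k + m)
  CCPath-++ nil q = q
  CCPath-++ (keep tr h p) q = keep tr h (CCPath-++ p q)
  CCPath-++ (change tr h p) q = change tr h (CCPath-++ p q)

  -- A path from βγ to ε must first consume β.
  CCPath-split : ∀ {n} γ β → CCPath G s [] n → s ≡ β ++ γ →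
                 ∃[ k ] ∃[ r ] (CCPathIn γ β k × CCPath G γ [] r × n ≡ k + r)
  CCPath-split γ [] p refl = 0 , _ , nil , p , refl
  CCPath-split γ (X ∷ β) (keep tr h p) refl with ⟶-inv tr refl
  ... | ξ , r , refl with CCPath-split γ (ξ ++ β) p (sym (++-assoc ξ β γ))
  ...   | k , m , q , p' , e = k , m , keep r (subst (X ∷ β ++ γ ≈_) (sym (++-assoc ξ β γ)) h) q , p' , e
  CCPath-split γ (X ∷ β) (change tr h p) refl with ⟶-inv tr refl
  ... | ξ , r , refl with CCPath-split γ (ξ ++ β) p (sym (++-assoc ξ β γ))
  ...   | k , m , q , p' , e =
          suc k , m , change r (h ∘ subst (X ∷ β ++ γ ≈_) (++-assoc ξ β γ)) q , p' , cong suc e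

  ccNorm-shift-≤ : ∀ {γ δ} → (∀ α β → (α ++ γ ≈ β ++ γ) ⇔ (α ++ δ ≈ β ++ δ)) →
                   ∀ α {a b c d} → IsCcNorm G (α ++ γ) a → IsCcNorm G γ b →
                   IsCcNorm G (α ++ δ) c → IsCcNorm G δ d → c + b ≤ a + d
  ccNorm-shift-≤ {γ} E α {b = b} {c} {d} (pathαγ , _) (_ , minimalγ) (_ , minimalαδ) (pathδ , _)
    with CCPath-split γ α pathαγ refl
  ... | k , r , q , pathγ , refl =
    begin
      c + b           ≤⟨ +-mono-≤ (minimalαδ _ (CCPath-++ (CCPathIn⇒CCPath (CCPathIn-transfer E q)) pathδ))
                                  (minimalγ r pathγ) ⟩
      (k + d) + r     ≡⟨ xy∙z≈xz∙y k d r ⟩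
      (k + r) + d     ∎
    where open ≤-Reasoning

a+d≡c+b⇒a-b≡c-d : ∀ a b c d → a + d ≡ c + b → + a - + b ≡ + c - + d
a+d≡c+b⇒a-b≡c-d a b c d eq = begin
  + a - + b          ≡⟨ [+m]-[+n]≡m⊖n a b ⟩
  a ⊖ b              ≡⟨ +-cancelˡ-⊖ d a b ⟨
  (d + a) ⊖ (d + b)  ≡⟨ cong₂ _⊖_ (trans (+-comm d a) (trans eq (+-comm c b))) (+-comm d b) ⟩
  (b + c) ⊖ (b + d)  ≡⟨ +-cancelˡ-⊖ b c d ⟩
  c ⊖ d              ≡⟨ [+m]-[+n]≡m⊖n c d ⟨
  + c - + d          ∎
  where open ≡-Reasoning

lemma1 : (G : BPA) → Normed G → NoSilentVariables G →
    (γ δ : List (Var G)) →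
    (∀ X → InRed G X γ ⇔ InRed G X δ) →
    (∀ α β → _∼_ G (α ++ γ) (β ++ γ) ⇔ _∼_ G (α ++ δ) (β ++ δ)) ×
    (∀ α (a b c d : ℕ) → IsCcNorm G (α ++ γ) a → IsCcNorm G γ b →
      IsCcNorm G (α ++ δ) c → IsCcNorm G δ d →
      (+ a) - (+ b) ≡ (+ c) - (+ d))
lemma1 G normed noSilent γ δ sameRed = ∼γ⇔∼δ , ccNorms
  where
  open BPATheory G
  ∼γ⇔∼δ : ∀ α β → (α ++ γ ≈ β ++ γ) ⇔ (α ++ δ ≈ β ++ δ)
  ∼γ⇔∼δ α β = mk⇔ (∼-transfer normed noSilent (Equivalence.to ∘ sameRed) α β)
                   (∼-transfer normed noSilent (Equivalence.from ∘ sameRed) α β)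
  ccNorms : ∀ α a b c d → IsCcNorm G (α ++ γ) a → IsCcNorm G γ b →
            IsCcNorm G (α ++ δ) c → IsCcNorm G δ d → + a - + b ≡ + c - + d
  ccNorms α a b c d ‖αγ‖ ‖γ‖ ‖αδ‖ ‖δ‖ = a+d≡c+b⇒a-b≡c-d a b c d (≤-antisym
    (ccNorm-shift-≤ (λ α β → ⇔.sym (∼γ⇔∼δ α β)) α ‖αδ‖ ‖δ‖ ‖αγ‖ ‖γ‖)
    (ccNorm-shift-≤ ∼γ⇔∼δ α ‖αγ‖ ‖γ‖ ‖αδ‖ ‖δ‖))
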